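{- Let $G$ be a complete signed graph, let $u\neq v$ with $\{u,v\}$ of sign $+$ in $G$, and let $H$ be obtained from $G$ by flipping the sign of $\{u,v\}$ to $-$. Let $w\notin N_{G^+}(u)\cup N_{G^+}(v)$. Then for every $x\in N_{G^+}(w)$, $x$ and $w$ are in $\varepsilon$-agreement in $G^+$ if and only if they are in $\varepsilon$-agreement in $H^+$.
   Context: A complete signed graph on a finite vertex set $V$ assigns to every unordered pair of distinct vertices a sign $+$ or $-$. For such a graph $X$, its positive graph $X^+$ has vertex set $V$ and as edges the pairs of sign $+$; $N_{X^+}(a)$ is the open neighborhood of $a$ in $X^+$. Fix $\varepsilon>0$. $\mathrm{NonAgreement}_{X^+}(a,b)=\frac{|N_{X^+}(a)\,\Delta\,N_{X^+}(b)|}{\max\{|N_{X^+}(a)|,|N_{X^+}(b)|\}}$. Vertices $a,b$ are in $\varepsilon$-agreement in $X^+$ if $\{a,b\}$ is an edge of $X^+$ and $\mathrm{NonAgreement}_{X^+}(a,b)<\varepsilon$.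
   Formalization: The parameter ε ranges over the positive rationals instead of the positive reals. -}

module Defs where

open import Data.Bool using (Bool; true; false; if_then_else_)
open import Data.Nat using (ℕ; zero; suc; _⊔_)
open import Data.Fin using (Fin; _≟_)
open import Data.Fin.Subset using (Subset; _∪_; _─_; ∣_∣)
open import Data.Vec using (tabulate)
open import Data.Integer using (+_)
open import Data.Rational using (ℚ; 0ℚ; _/_; _<_)
open import Data.Product using (_×_)
open import Relation.Nullary using (does)
open import Relation.Binary.PropositionalEquality using (_≡_; _≢_)

-- A complete signed graph on vertex set Fin n: a sign (true = +, false = -)
-- for every pair of vertices, symmetric. Diagonal values are irrelevant
-- (only pairs of distinct vertices are ever consulted).
record SignedGraph (n : ℕ) : Set where
  field
    sign : Fin n → Fin n → Bool
    sign-sym : ∀ x y → sign x y ≡ sign y x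
open SignedGraph public

PosEdge : ∀ {n} → SignedGraph n → Fin n → Fin n → Set
PosEdge X a b = (a ≢ b) × (sign X a b ≡ true)

N⁺ : ∀ {n} → SignedGraph n → Fin n → Subset n
N⁺ X a = tabulate λ b → if does (a ≟ b) then false else sign X a b

_Δ_ : ∀ {n} → Subset n → Subset n → Subset n
p Δ q = (p ─ q) ∪ (q ─ p)

-- NonAgreement_{X⁺}(a,b) = |N(a) Δ N(b)| / max(|N(a)|,|N(b)|)
-- (convention: 0 when both neighbourhoods are empty; never used for edges).
NonAgreement : ∀ {n} → SignedGraph n → Fin n → Fin n → ℚ
NonAgreement X a b with ∣ N⁺ X a ∣ ⊔ ∣ N⁺ X b ∣
... | zero = 0ℚ
... | suc m = (+ ∣ N⁺ X a Δ N⁺ X b ∣) / suc m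

InAgreement : ∀ {n} → ℚ → SignedGraph n → Fin n → Fin n → Set
InAgreement ε X a b = PosEdge X a b × (NonAgreement X a b < ε)

{-# OPTIONS --safe #-}
module Submission where

open import Defs
open import Data.Bool using (true; false; if_then_else_)
open import Data.Nat using (ℕ; zero; suc; _⊔_)
open import Data.Fin using (Fin; _≟_)
open import Data.Fin.Subset using (Subset; _∈_; _∉_; _∪_; ∣_∣)
open import Data.Fin.Subset.Properties using (p⊆p∪q; q⊆p∪q)
open import Data.Vec.Properties using (tabulate-cong; lookup∘tabulate; []=⇒lookup; lookup⇒[]=)
open import Data.Integer using (+_)
open import Data.Rational using (ℚ; 0ℚ; _<_; _/_)
open import Data.Product using (_×_; _,_)
open import Data.Sum using (_⊎_; inj₁; inj₂)
open import Data.Empty using (⊥-elim)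
open import Relation.Nullary using (¬_; yes; no; does)
open import Relation.Binary.PropositionalEquality
open import Function.Bundles using (_⇔_; mk⇔)

-- The agreement of x and w only depends on the neighbourhoods of x and w, and
-- flipping {u, v} changes only the neighbourhoods of u and v. Neither x nor w
-- is u or v: w is adjacent to neither of them, while u and v are adjacent to
-- each other and x is adjacent to w.

module _ {n : ℕ} where

  ∈N⁺⇒PosEdge : ∀ (X : SignedGraph n) {a b} → b ∈ N⁺ X a → PosEdge X a b
  ∈N⁺⇒PosEdge X {a} {b} b∈Na with a ≟ b | trans (sym (lookup∘tabulate _ b)) ([]=⇒lookup b∈Na)
  ... | no a≢b | sign≡true = a≢b , sign≡true

  PosEdge⇒∈N⁺ : ∀ (X : SignedGraph n) {a b} → PosEdge X a b → b ∈ N⁺ X a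
  PosEdge⇒∈N⁺ X {a} {b} (a≢b , sign≡true) =
    lookup⇒[]= b _ (trans (lookup∘tabulate _ b) entry)
    where
    entry : (if does (a ≟ b) then false else sign X a b) ≡ true
    entry with a ≟ b
    ... | yes a≡b = ⊥-elim (a≢b a≡b)
    ... | no _    = sign≡true

  PosEdge-sym : ∀ (X : SignedGraph n) {a b} → PosEdge X a b → PosEdge X b a
  PosEdge-sym X {a} {b} (a≢b , sign≡true) = (λ b≡a → a≢b (sym b≡a)) , trans (sign-sym X b a) sign≡true

  ∈N⁺-sym : ∀ (X : SignedGraph n) {a b} → b ∈ N⁺ X a → a ∈ N⁺ X b
  ∈N⁺-sym X b∈Na = PosEdge⇒∈N⁺ X (PosEdge-sym X (∈N⁺⇒PosEdge X b∈Na))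

  N⁺-cong : ∀ (X Y : SignedGraph n) {a} → (∀ b → a ≢ b → sign X a b ≡ sign Y a b) → N⁺ X a ≡ N⁺ Y a
  N⁺-cong X Y {a} signs≡ = tabulate-cong entry
    where
    entry : ∀ b → (if does (a ≟ b) then false else sign X a b)
                ≡ (if does (a ≟ b) then false else sign Y a b)
    entry b with a ≟ b
    ... | yes _   = refl
    ... | no a≢b  = signs≡ b a≢b

  nonAgreement : Subset n → Subset n → ℚ
  nonAgreement p q with ∣ p ∣ ⊔ ∣ q ∣
  ... | zero  = 0ℚ
  ... | suc m = (+ ∣ p Δ q ∣) / suc m

  NonAgreement≡nonAgreement : ∀ (X : SignedGraph n) a b → NonAgreement X a b ≡ nonAgreement (N⁺ X a) (N⁺ X b)
  NonAgreement≡nonAgreement X a b with ∣ N⁺ X a ∣ ⊔ ∣ N⁺ X b ∣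
  ... | zero  = refl
  ... | suc m = refl

  InAgreement-cong : ∀ (ε : ℚ) (X Y : SignedGraph n) {a b} → N⁺ X a ≡ N⁺ Y a → N⁺ X b ≡ N⁺ Y b
                   → InAgreement ε X a b ⇔ InAgreement ε Y a b
  InAgreement-cong ε X Y {a} {b} Na≡ Nb≡ = mk⇔ (transfer X Y Na≡ Nb≡) (transfer Y X (sym Na≡) (sym Nb≡))
    where
    transfer : ∀ X Y → N⁺ X a ≡ N⁺ Y a → N⁺ X b ≡ N⁺ Y b → InAgreement ε X a b → InAgreement ε Y a b
    transfer X Y Na≡ Nb≡ (edge , small) =
      ∈N⁺⇒PosEdge Y (subst (b ∈_) Na≡ (PosEdge⇒∈N⁺ X edge)) ,
      subst (_< ε) NonAgreement≡ small
      where
      NonAgreement≡ : NonAgreement X a b ≡ NonAgreement Y a b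
      NonAgreement≡ = begin
        NonAgreement X a b                ≡⟨ NonAgreement≡nonAgreement X a b ⟩
        nonAgreement (N⁺ X a) (N⁺ X b)    ≡⟨ cong₂ nonAgreement Na≡ Nb≡ ⟩
        nonAgreement (N⁺ Y a) (N⁺ Y b)    ≡⟨ sym (NonAgreement≡nonAgreement Y a b) ⟩
        NonAgreement Y a b                ∎
        where open ≡-Reasoning

proposition4 : (ε : ℚ) → 0ℚ < ε → (n : ℕ) → (G H : SignedGraph n) → (u v : Fin n)
    → u ≢ v → sign G u v ≡ true
    → sign H u v ≡ false
    → (∀ x y → x ≢ y → ¬ ((x ≡ u × y ≡ v) ⊎ (x ≡ v × y ≡ u)) → sign H x y ≡ sign G x y)
    → (w : Fin n) → w ∉ (N⁺ G u ∪ N⁺ G v)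
    → ∀ x → x ∈ N⁺ G w
    → InAgreement ε G x w ⇔ InAgreement ε H x w
proposition4 ε _ n G H u v u≢v Guv _ H≡G-off-uv w w∉Nu∪Nv x x∈Nw =
  InAgreement-cong ε G H (N⁺-unchanged x≢u x≢v) (N⁺-unchanged w≢u w≢v)
  where
  w∉Nu : w ∉ N⁺ G u
  w∉Nu w∈Nu = w∉Nu∪Nv (p⊆p∪q (N⁺ G v) w∈Nu)
  w∉Nv : w ∉ N⁺ G v
  w∉Nv w∈Nv = w∉Nu∪Nv (q⊆p∪q (N⁺ G u) (N⁺ G v) w∈Nv)
  v∈Nu : v ∈ N⁺ G u
  v∈Nu = PosEdge⇒∈N⁺ G (u≢v , Guv)
  w≢u : w ≢ u
  w≢u refl = w∉Nv (∈N⁺-sym G v∈Nu)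
  w≢v : w ≢ v
  w≢v refl = w∉Nu v∈Nu
  x≢u : x ≢ u
  x≢u refl = w∉Nu (∈N⁺-sym G x∈Nw)
  x≢v : x ≢ v
  x≢v refl = w∉Nv (∈N⁺-sym G x∈Nw)
  N⁺-unchanged : ∀ {a} → a ≢ u → a ≢ v → N⁺ G a ≡ N⁺ H a
  N⁺-unchanged {a} a≢u a≢v = N⁺-cong G H λ b a≢b →
    sym (H≡G-off-uv a b a≢b λ { (inj₁ (a≡u , _)) → a≢u a≡u ; (inj₂ (a≡v , _)) → a≢v a≡v })
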